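{- Let $W$ be a nonempty set and $B$ a family of subsets of $W$ containing $\emptyset$ and $W$ and closed under $\cup$. Define on $B$: $0=\emptyset$, $1=W$, $a+b=a\cup b$, $a\leq b$ iff $a\subseteq b$, and $aCb$ iff $a\cap b\neq\emptyset$. Then $(B,\leq,0,1,+,C)$ is a contact join-semilattice.
   Context: A contact join-semilattice (CJS) is a structure $(B,\leq,0,1,+,C)$ satisfying for all elements: (1) $x\leq x$; (2) $x\leq y\wedge y\leq x\rightarrow x=y$; (3) $x\leq y\wedge y\leq z\rightarrow x\leq z$; (4) $x+y=y+x$; (5) $x\leq x+y$; (6) $x\leq z\wedge y\leq z\rightarrow x+y\leq z$; (7) $0\leq x$; (8) $x\leq 1$; (9) $xCy\rightarrow x\neq 0$; (10) $xCy\rightarrow yCx$; and for all integers $m,i,n\geq1$: $A^1_{m,i}$: if $xCy$, and $x\leq s_j^1+\dots+s_j^i$ and $y\leq t_j^1+\dots+t_j^i$ for every $j=1,\dots,m$, then there are $l_1,\dots,l_m,k_1,\dots,k_m\in\{1,\dots,i\}$ with $s_j^{l_j}Cs_u^{l_u}$ and $t_j^{k_j}Ct_u^{k_u}$ for all $1\leq j\leq u\leq m$, and $s_j^{l_j}Ct_u^{k_u}$ for all $j,u\in\{1,\dots,m\}$; $A_{n,i}$: if $t\not\leq u$ and $t\leq x_k^1+\dots+x_k^i$ for every $k=1,\dots,n$, then there are $j_1,\dots,j_n\in\{1,\dots,i\}$ with $x_k^{j_k}\not\leq u$ for all $k$ and $x_k^{j_k}Cx_l^{j_l}$ for all $k,l\in\{1,\dots,n\}$.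 -}

module Defs where

open import Level using (Level; 0ℓ; _⊔_) renaming (suc to lsuc)
open import Data.Nat using (ℕ; zero; suc)
open import Data.Fin using (Fin; zero; suc) renaming (_≤_ to _≤ᶠ_)
open import Data.Product using (Σ; ∃; _×_; _,_; proj₁)
open import Relation.Nullary using (¬_)
open import Relation.Unary using (Pred; _∈_; _⊆_; _≐_; _∪_; _∩_; ∅; U; Empty)

bigJoin : ∀ {a} {A : Set a} → (A → A → A) → (i : ℕ) → (Fin (suc i) → A) → A
bigJoin _+_ zero    s = s zero
bigJoin _+_ (suc i) s = s zero + bigJoin _+_ i (λ k → s (suc k))

-- The positive integers m, i, n ≥ 1 are represented as suc m, suc i, suc n
-- and the index sets {1,…,k} as Fin (suc k).
record IsCJS {a ℓ₁ ℓ₂ ℓ₃ : Level} (B : Set a)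
             (_≈_ : B → B → Set ℓ₁) (_≤_ : B → B → Set ℓ₂)
             (𝟎 𝟏 : B) (_+_ : B → B → B) (_C_ : B → B → Set ℓ₃)
             : Set (a ⊔ ℓ₁ ⊔ ℓ₂ ⊔ ℓ₃) where
  field
    refl≤   : ∀ x → x ≤ x
    antisym : ∀ x y → x ≤ y → y ≤ x → x ≈ y
    trans≤  : ∀ x y z → x ≤ y → y ≤ z → x ≤ z
    +-comm  : ∀ x y → (x + y) ≈ (y + x)
    ≤+      : ∀ x y → x ≤ (x + y)
    +-lub   : ∀ x y z → x ≤ z → y ≤ z → (x + y) ≤ z
    0-min   : ∀ x → 𝟎 ≤ x
    1-max   : ∀ x → x ≤ 𝟏
    C-nz    : ∀ x y → x C y → ¬ (x ≈ 𝟎)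
    C-sym   : ∀ x y → x C y → y C x
    A¹ : ∀ m i (x y : B) (s t : Fin (suc m) → Fin (suc i) → B) →
         x C y →
         (∀ j → x ≤ bigJoin _+_ i (s j)) →
         (∀ j → y ≤ bigJoin _+_ i (t j)) →
         Σ (Fin (suc m) → Fin (suc i)) λ l →
         Σ (Fin (suc m) → Fin (suc i)) λ k →
           (∀ j u → j ≤ᶠ u → s j (l j) C s u (l u)) ×
           (∀ j u → j ≤ᶠ u → t j (k j) C t u (k u)) ×
           (∀ j u → s j (l j) C t u (k u))
    A  : ∀ n i (t u : B) (x : Fin (suc n) → Fin (suc i) → B) →
         ¬ (t ≤ u) →
         (∀ k → t ≤ bigJoin _+_ i (x k)) →
         Σ (Fin (suc n) → Fin (suc i)) λ j →
           (∀ k → ¬ (x k (j k) ≤ u)) ×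
           (∀ k l → x k (j k) C x l (j l))

module SetFamily (W : Set) (B : Pred (Pred W 0ℓ) 0ℓ) where

  Elt : Set₁
  Elt = Σ (Pred W 0ℓ) (λ a → a ∈ B)

  _≈ₛ_ : Elt → Elt → Set
  a ≈ₛ b = proj₁ a ≐ proj₁ b

  _≤ₛ_ : Elt → Elt → Set
  a ≤ₛ b = proj₁ a ⊆ proj₁ b

  _Cₛ_ : Elt → Elt → Set
  a Cₛ b = ¬ Empty (proj₁ a ∩ proj₁ b)

  module _ (∅∈B : ∅ ∈ B) (W∈B : U ∈ B)
           (∪∈B : ∀ a b → a ∈ B → b ∈ B → (a ∪ b) ∈ B) where

    𝟎ₛ : Elt
    𝟎ₛ = ∅ , ∅∈B

    𝟏ₛ : Elt
    𝟏ₛ = U , W∈B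

    _+ₛ_ : Elt → Elt → Elt
    (a , a∈) +ₛ (b , b∈) = (a ∪ b) , ∪∈B a b a∈ b∈

-- Given a point in x ∩ y (resp. in t but not in u),
-- each cover s¹ ∪ … ∪ sⁱ of x, y or t has a member containing that point; choosing these
-- members gives the indices required by A¹ and A, and any two chosen sets meet in the point.
-- Excluded middle is needed only to extract the point from ¬ (x ∩ y = ∅) and from t ⊈ u.
module Submission where

open import Defs
open import Level using (Level; 0ℓ)
open import Relation.Unary
  using (Pred; _∈_; _⊆_; _∪_; _∩_; ∁; ∅; U; Empty; Satisfiable)
open import Axiom.ExcludedMiddle using (ExcludedMiddle)
open import Axiom.DoubleNegationElimination using (DoubleNegationElimination; em⇒dne)
open import Data.Nat using (zero; suc)
open import Data.Fin using (Fin; zero; suc)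
open import Data.Product using (∃; _×_; _,_; proj₁; proj₂)
open import Data.Sum using (inj₁; inj₂; [_,_]; swap)
open import Data.Unit using (tt)
open import Relation.Nullary using (¬_)
open import Function using (_∘_)

private
  variable
    a ℓ : Level
    W : Set

∈-bigJoin⁻ : {A : Set a} (f : A → Pred W ℓ) (_+_ : A → A → A) →
             (∀ x y → f (x + y) ⊆ f x ∪ f y) →
             ∀ i (s : Fin (suc i) → A) {w} → w ∈ f (bigJoin _+_ i s) →
             ∃ λ k → w ∈ f (s k)
∈-bigJoin⁻ f _+_ f-+ zero    s w∈ = zero , w∈
∈-bigJoin⁻ f _+_ f-+ (suc i) s w∈ with f-+ (s zero) (bigJoin _+_ i (λ k → s (suc k))) w∈
... | inj₁ w∈s₀ = zero , w∈s₀
... | inj₂ w∈rest =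
  let k , w∈sₖ = ∈-bigJoin⁻ f _+_ f-+ i (λ k → s (suc k)) w∈rest in suc k , w∈sₖ

module _ (dne : DoubleNegationElimination ℓ) {P : Pred W ℓ} where

  ¬Empty⇒Satisfiable : ¬ Empty P → Satisfiable P
  ¬Empty⇒Satisfiable ¬empty = dne λ ¬sat → ¬empty λ w w∈P → ¬sat (w , w∈P)

  ⊈⇒Satisfiable-∖ : {Q : Pred W ℓ} → ¬ (P ⊆ Q) → Satisfiable (P ∩ ∁ Q)
  ⊈⇒Satisfiable-∖ P⊈Q = dne λ ¬sat → P⊈Q λ {w} w∈P → dne λ w∉Q → ¬sat (w , w∈P , w∉Q)

module SetFamilyIsCJS (em : ExcludedMiddle 0ℓ) (W : Set) (B : Pred (Pred W 0ℓ) 0ℓ)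
  (∅∈B : ∅ ∈ B) (W∈B : U ∈ B) (∪∈B : ∀ a b → a ∈ B → b ∈ B → (a ∪ b) ∈ B) where

  open SetFamily W B

  private
    _+_ : Elt → Elt → Elt
    _+_ = _+ₛ_ ∅∈B W∈B ∪∈B

    dne : DoubleNegationElimination 0ℓ
    dne = em⇒dne em

  C-intro : ∀ {w} (x y : Elt) → w ∈ proj₁ x → w ∈ proj₁ y → x Cₛ y
  C-intro x y w∈x w∈y empty = empty _ (w∈x , w∈y)

  choose : ∀ i (s : Fin (suc i) → Elt) {w} → w ∈ proj₁ (bigJoin _+_ i s) →
           ∃ λ k → w ∈ proj₁ (s k)
  choose = ∈-bigJoin⁻ proj₁ _+_ (λ _ _ w∈ → w∈)

  A¹-holds : ∀ m i (x y : Elt) (s t : Fin (suc m) → Fin (suc i) → Elt) → x Cₛ y →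
             (∀ j → x ≤ₛ bigJoin _+_ i (s j)) → (∀ j → y ≤ₛ bigJoin _+_ i (t j)) →
             ∃ λ (l : Fin (suc m) → Fin (suc i)) → ∃ λ (k : Fin (suc m) → Fin (suc i)) →
               (∀ j u → s j (l j) Cₛ s u (l u)) ×
               (∀ j u → t j (k j) Cₛ t u (k u)) ×
               (∀ j u → s j (l j) Cₛ t u (k u))
  A¹-holds m i x y s t xCy x≤ y≤ =
      proj₁ ∘ in-s , proj₁ ∘ in-t
    , (λ j u → C-intro (s j _) (s u _) (proj₂ (in-s j)) (proj₂ (in-s u)))
    , (λ j u → C-intro (t j _) (t u _) (proj₂ (in-t j)) (proj₂ (in-t u)))
    , (λ j u → C-intro (s j _) (t u _) (proj₂ (in-s j)) (proj₂ (in-t u)))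
    where
    common : Satisfiable (proj₁ x ∩ proj₁ y)
    common = ¬Empty⇒Satisfiable dne xCy

    in-s : ∀ j → ∃ λ l → proj₁ common ∈ proj₁ (s j l)
    in-s j = choose i (s j) (x≤ j (proj₁ (proj₂ common)))

    in-t : ∀ j → ∃ λ k → proj₁ common ∈ proj₁ (t j k)
    in-t j = choose i (t j) (y≤ j (proj₂ (proj₂ common)))

  A-holds : ∀ n i (t u : Elt) (x : Fin (suc n) → Fin (suc i) → Elt) → ¬ (t ≤ₛ u) →
            (∀ k → t ≤ₛ bigJoin _+_ i (x k)) →
            ∃ λ (j : Fin (suc n) → Fin (suc i)) →
              (∀ k → ¬ (x k (j k) ≤ₛ u)) × (∀ k l → x k (j k) Cₛ x l (j l))
  A-holds n i t u x t≰u t≤ =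
      proj₁ ∘ in-x
    , (λ k x≤u → proj₂ (proj₂ witness) (x≤u (proj₂ (in-x k))))
    , (λ k l → C-intro (x k _) (x l _) (proj₂ (in-x k)) (proj₂ (in-x l)))
    where
    witness : Satisfiable (proj₁ t ∩ ∁ (proj₁ u))
    witness = ⊈⇒Satisfiable-∖ dne t≰u

    in-x : ∀ k → ∃ λ j → proj₁ witness ∈ proj₁ (x k j)
    in-x k = choose i (x k) (t≤ k (proj₁ (proj₂ witness)))

  isCJS : IsCJS Elt _≈ₛ_ _≤ₛ_ (𝟎ₛ ∅∈B W∈B ∪∈B) (𝟏ₛ ∅∈B W∈B ∪∈B) _+_ _Cₛ_
  isCJS = record
    { refl≤   = λ _ w∈ → w∈
    ; antisym = λ _ _ x⊆y y⊆x → x⊆y , y⊆x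
    ; trans≤  = λ _ _ _ x⊆y y⊆z w∈ → y⊆z (x⊆y w∈)
    ; +-comm  = λ _ _ → swap , swap
    ; ≤+      = λ _ _ → inj₁
    ; +-lub   = λ _ _ _ x⊆z y⊆z → [ x⊆z , y⊆z ]
    ; 0-min   = λ _ ()
    ; 1-max   = λ _ _ → tt
    ; C-nz    = λ x y xCy x≈∅ → xCy λ _ w∈ → proj₁ x≈∅ (proj₁ w∈)
    ; C-sym   = λ x y xCy empty → xCy λ w (w∈x , w∈y) → empty w (w∈y , w∈x)
    ; A¹      = λ m i x y s t xCy x≤ y≤ →
                  let l , k , sCs , tCt , sCt = A¹-holds m i x y s t xCy x≤ y≤
                  in l , k , (λ j u _ → sCs j u) , (λ j u _ → tCt j u) , sCt
    ; A       = A-holds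
    }

mainTheorem11 : ExcludedMiddle 0ℓ →
    (W : Set) → W →
    (B : Pred (Pred W 0ℓ) 0ℓ) →
    (∅∈B : ∅ ∈ B) → (W∈B : U ∈ B) →
    (∪∈B : ∀ a b → a ∈ B → b ∈ B → (a ∪ b) ∈ B) →
    IsCJS (SetFamily.Elt W B) (SetFamily._≈ₛ_ W B) (SetFamily._≤ₛ_ W B)
    (SetFamily.𝟎ₛ W B ∅∈B W∈B ∪∈B) (SetFamily.𝟏ₛ W B ∅∈B W∈B ∪∈B)
    (SetFamily._+ₛ_ W B ∅∈B W∈B ∪∈B) (SetFamily._Cₛ_ W B)
mainTheorem11 em W _ B ∅∈B W∈B ∪∈B = SetFamilyIsCJS.isCJS em W B ∅∈B W∈B ∪∈B
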